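{- For every integer $n\ge1$ and every permutation $\pi\in\mathfrak S_n$, $((b-ca)+(ba))\,\pi=((b-ac)+(b-a])\,\pi$.
   Context: $\mathfrak S_n$ is the set of permutations $\pi=\pi_1\cdots\pi_n$ of $\{1,\dots,n\}$. Vincular pattern counts: $(b-ca)\,\pi=\#\{(i,j):i<j<n,\ \pi_{j+1}<\pi_i<\pi_j\}$; $(ba)\,\pi=\#\{i<n:\pi_i>\pi_{i+1}\}$; $(b-ac)\,\pi=\#\{(i,j):i<j<n,\ \pi_j<\pi_i<\pi_{j+1}\}$; $(b-a])\,\pi=\#\{i<n:\pi_i>\pi_n\}$. $(\sigma+\tau)\,\pi$ denotes the sum of the counts. -}

module Defs where

open import Data.Nat using (ℕ; zero; suc; _+_; _<_; _≤_)
open import Data.Nat.Properties using (_<?_)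
open import Data.Fin using (Fin; toℕ)
open import Data.Fin.Permutation using (Permutation′; _⟨$⟩ʳ_)
open import Data.List using (List; []; _∷_; upTo; length; filter; concatMap; map)
open import Data.Product using (_×_; _,_)
open import Relation.Nullary using (Dec; yes; no)
open import Relation.Nullary.Decidable using (_×-dec_)

-- A permutation π ∈ 𝔖_n is a bijection Fin n → Fin n; we use 0-based
-- positions and values: value at position i is  val π i = toℕ (π ⟨$⟩ʳ i).
-- Out-of-range positions (i ≥ n) get the dummy value 0; they are never used
-- because all positions below range over  upTo n / upTo (n ∸ 1) etc.
val : ∀ {n} → Permutation′ n → ℕ → ℕ
val {n} π i with i <? n
... | yes i<n = toℕ (π ⟨$⟩ʳ Data.Fin.fromℕ< i<n)
... | no _ = 0


-- pairs (i , j) with i < j and j + 1 < n  (i.e. 1-based i<j<n)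
pairs : ℕ → List (ℕ × ℕ)
pairs n = concatMap (λ j → map (λ i → (i , j)) (upTo j)) (upTo (n Data.Nat.∸ 1))

-- positions i with i + 1 < n  (i.e. 1-based i < n)
positions : ℕ → List ℕ
positions n = upTo (n Data.Nat.∸ 1)

pat-b-ca : ∀ {n} → Permutation′ n → ℕ
pat-b-ca {n} π = length (filter
  (λ { (i , j) → (val π (suc j) <? val π i) ×-dec (val π i <? val π j) })
  (pairs n))

pat-ba : ∀ {n} → Permutation′ n → ℕ
pat-ba {n} π = length (filter (λ i → val π (suc i) <? val π i) (positions n))

pat-b-ac : ∀ {n} → Permutation′ n → ℕ
pat-b-ac {n} π = length (filter
  (λ { (i , j) → (val π j <? val π i) ×-dec (val π i <? val π (suc j)) })
  (pairs n))

pat-b-a] : ∀ {n} → Permutation′ n → ℕ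
pat-b-a] {n} π = length (filter (λ i → val π (n Data.Nat.∸ 1) <? val π i) (positions n))

-- Induct on the length of a prefix of π.  Appending c after the last entry b
-- adds #{i : c < π_i < b} + [c < b] to the left side and #{i : b < π_i < c} to
-- (b-ac), while (b-a]) changes from #{i : π_i > b} to #{i : π_i > c} + [c < b],
-- where i ranges over the entries before b.  The step thus reduces, for each
-- earlier entry x, to [b < x] + [c < x < b] = [b < x < c] + [c < x]; both
-- sides equal [min b c < x] since x ∉ {b, c}.
module Submission where

open import Defs
open import Data.Nat using (ℕ; zero; suc; _+_; _≥_; _<_; _≤_; s≤s)
open import Data.Nat.Properties
  using (_<?_; +-identityʳ; +-assoc; +-commutativeSemigroup; <-asym; <-irrefl; ≤-antisym;
         ≮⇒≥; ≤-refl; m<n⇒m<1+n; n<1+n; m≤n⇒m≤1+n; <-≤-trans)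
open import Algebra.Properties.CommutativeSemigroup +-commutativeSemigroup using (interchange)
open import Data.Fin using (toℕ; fromℕ<)
open import Data.Fin.Properties using (toℕ-injective; fromℕ<-injective)
open import Data.Fin.Permutation using (Permutation′; _⟨$⟩ʳ_)
open import Function.Bundles using (Injection)
open import Function.Properties.Inverse using (↔⇒↣)
open import Data.List using (List; []; _∷_; upTo; length; filter; concatMap; map; _++_)
open import Data.List.Properties using (upTo-∷ʳ; map-++; map-∘)
open import Data.Nat.ListAction using (sum)
open import Data.Nat.ListAction.Properties using (sum-++)
open import Data.Product using (_×_; _,_)
open import Data.Bool using (true; false; if_then_else_)
open import Relation.Nullary using (Dec; yes; no; does)
open import Relation.Nullary.Decidable using (_×-dec_)
open import Relation.Unary using (Pred; Decidable)
open import Data.Empty using (⊥-elim)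
open import Relation.Binary.PropositionalEquality
  using (_≡_; _≢_; refl; sym; trans; cong; cong₂; module ≡-Reasoning)

iverson : ∀ {p} {P : Set p} → Dec P → ℕ
iverson P? = if does P? then 1 else 0

length-filter : ∀ {a p} {A : Set a} {P : Pred A p} (P? : Decidable P) (xs : List A) →
  length (filter P? xs) ≡ sum (map (λ x → iverson (P? x)) xs)
length-filter P? [] = refl
length-filter P? (x ∷ xs) with does (P? x)
... | true  = cong suc (length-filter P? xs)
... | false = length-filter P? xs

∑< : ℕ → (ℕ → ℕ) → ℕ
∑< zero    f = 0
∑< (suc k) f = ∑< k f + f k

syntax ∑< k (λ i → e) = ∑[ i < k ] e

∑-cong : ∀ {f g} k → (∀ i → i < k → f i ≡ g i) → ∑< k f ≡ ∑< k g
∑-cong zero    f≡g = refl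
∑-cong (suc k) f≡g = cong₂ _+_ (∑-cong k (λ i i<k → f≡g i (m<n⇒m<1+n i<k))) (f≡g k (n<1+n k))

∑-distrib-+ : ∀ f g k → ∑[ i < k ] (f i + g i) ≡ ∑< k f + ∑< k g
∑-distrib-+ f g zero    = refl
∑-distrib-+ f g (suc k) = begin
  ∑[ i < k ] (f i + g i) + (f k + g k) ≡⟨ cong (_+ (f k + g k)) (∑-distrib-+ f g k) ⟩
  (∑< k f + ∑< k g) + (f k + g k)      ≡⟨ interchange (∑< k f) (∑< k g) (f k) (g k) ⟩
  (∑< k f + f k) + (∑< k g + g k)      ∎
  where open ≡-Reasoning

sum-map-upTo : ∀ f k → sum (map f (upTo k)) ≡ ∑< k f
sum-map-upTo f zero    = refl
sum-map-upTo f (suc k) = begin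
  sum (map f (upTo (suc k)))       ≡⟨ cong (λ l → sum (map f l)) (sym (upTo-∷ʳ k)) ⟩
  sum (map f (upTo k ++ k ∷ []))   ≡⟨ cong sum (map-++ f (upTo k) (k ∷ [])) ⟩
  sum (map f (upTo k) ++ f k ∷ []) ≡⟨ sum-++ (map f (upTo k)) (f k ∷ []) ⟩
  sum (map f (upTo k)) + (f k + 0) ≡⟨ cong₂ _+_ (sum-map-upTo f k) (+-identityʳ (f k)) ⟩
  ∑< k f + f k                     ∎
  where open ≡-Reasoning

sum-map-concatMap : ∀ {A B : Set} (f : B → ℕ) (g : A → List B) xs →
  sum (map f (concatMap g xs)) ≡ sum (map (λ x → sum (map f (g x))) xs)
sum-map-concatMap f g []       = refl
sum-map-concatMap f g (x ∷ xs) = begin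
  sum (map f (g x ++ concatMap g xs))              ≡⟨ cong sum (map-++ f (g x) (concatMap g xs)) ⟩
  sum (map f (g x) ++ map f (concatMap g xs))      ≡⟨ sum-++ (map f (g x)) _ ⟩
  sum (map f (g x)) + sum (map f (concatMap g xs)) ≡⟨ cong (sum (map f (g x)) +_) (sum-map-concatMap f g xs) ⟩
  sum (map f (g x)) + sum (map (λ y → sum (map f (g y))) xs) ∎
  where open ≡-Reasoning

sum-map-pairs : ∀ (h : ℕ × ℕ → ℕ) k →
  sum (map h (pairs (suc k))) ≡ ∑[ j < k ] ∑[ i < j ] h (i , j)
sum-map-pairs h k = begin
  sum (map h (pairs (suc k)))
    ≡⟨ sum-map-concatMap h (λ j → map (λ i → (i , j)) (upTo j)) (upTo k) ⟩
  sum (map (λ j → sum (map h (map (λ i → (i , j)) (upTo j)))) (upTo k))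
    ≡⟨ sum-map-upTo _ k ⟩
  ∑[ j < k ] sum (map h (map (λ i → (i , j)) (upTo j)))
    ≡⟨ ∑-cong k (λ j _ → trans (cong sum (sym (map-∘ (upTo j)))) (sum-map-upTo _ j)) ⟩
  ∑[ j < k ] ∑[ i < j ] h (i , j) ∎
  where open ≡-Reasoning

iverson-min-< : ∀ {x p q} → x ≢ p → x ≢ q →
  iverson (p <? x) + iverson ((q <? x) ×-dec (x <? p)) ≡ iverson ((p <? x) ×-dec (x <? q)) + iverson (q <? x)
iverson-min-< {x} {p} {q} x≢p x≢q = cases (p <? x) (q <? x) (x <? p) (x <? q)
  where
  cases : (p<x? : Dec (p < x)) (q<x? : Dec (q < x)) (x<p? : Dec (x < p)) (x<q? : Dec (x < q)) →
    iverson p<x? + iverson (q<x? ×-dec x<p?) ≡ iverson (p<x? ×-dec x<q?) + iverson q<x?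
  cases (yes p<x) _         (yes x<p) _         = ⊥-elim (<-asym p<x x<p)
  cases _         (yes q<x) _         (yes x<q) = ⊥-elim (<-asym q<x x<q)
  cases (no p≮x)  _         (no x≮p)  _         = ⊥-elim (x≢p (≤-antisym (≮⇒≥ p≮x) (≮⇒≥ x≮p)))
  cases _         (no q≮x)  _         (no x≮q)  = ⊥-elim (x≢q (≤-antisym (≮⇒≥ q≮x) (≮⇒≥ x≮q)))
  cases (yes _)   (yes _)   (no _)    (no _)    = refl
  cases (yes _)   (no _)    (no _)    (yes _)   = refl
  cases (no _)    (yes _)   (yes _)   (no _)    = refl
  cases (no _)    (no _)    (yes _)   (yes _)   = refl

length-filter-positions : ∀ {p} {P : Pred ℕ p} (P? : Decidable P) k →
  length (filter P? (positions (suc k))) ≡ ∑[ i < k ] iverson (P? i)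
length-filter-positions P? k = trans (length-filter P? (upTo k)) (sum-map-upTo _ k)

length-filter-pairs : ∀ {p} {P : Pred (ℕ × ℕ) p} (P? : Decidable P) k →
  length (filter P? (pairs (suc k))) ≡ ∑[ j < k ] ∑[ i < j ] iverson (P? (i , j))
length-filter-pairs P? k = trans (length-filter P? (pairs (suc k))) (sum-map-pairs _ k)

-- Counts for the prefix a 0, …, a k (0-based); the theorem is a = val π, k = n − 1.
module PrefixCounts (a : ℕ → ℕ) where

  above : ℕ → ℕ → ℕ
  above v k = ∑[ i < k ] iverson (v <? a i)

  between : ℕ → ℕ → ℕ → ℕ
  between v w k = ∑[ i < k ] iverson ((v <? a i) ×-dec (a i <? w))

  b-ca ba b-ac b-a] : ℕ → ℕ
  b-ca k = ∑[ j < k ] between (a (suc j)) (a j) j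
  ba   k = ∑[ i < k ] iverson (a (suc i) <? a i)
  b-ac k = ∑[ j < k ] between (a j) (a (suc j)) j
  b-a] k = above (a k) k

  DistinctUpTo : ℕ → Set
  DistinctUpTo k = ∀ {i j} → i < j → j ≤ k → a i ≢ a j

  above-between-exchange : ∀ {p q} k → (∀ i → i < k → a i ≢ p) → (∀ i → i < k → a i ≢ q) →
    above p k + between q p k ≡ between p q k + above q k
  above-between-exchange {p} {q} k ≢p ≢q = begin
    above p k + between q p k                                      ≡⟨ sym (∑-distrib-+ _ _ k) ⟩
    ∑[ i < k ] (iverson (p <? a i) + iverson ((q <? a i) ×-dec (a i <? p)))
      ≡⟨ ∑-cong k (λ i i<k → iverson-min-< (≢p i i<k) (≢q i i<k)) ⟩
    ∑[ i < k ] (iverson ((p <? a i) ×-dec (a i <? q)) + iverson (q <? a i)) ≡⟨ ∑-distrib-+ _ _ k ⟩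
    between p q k + above q k                                      ∎
    where open ≡-Reasoning

  b-ca+ba≡b-ac+b-a] : ∀ k → DistinctUpTo k → b-ca k + ba k ≡ b-ac k + b-a] k
  b-ca+ba≡b-ac+b-a] zero    _        = refl
  b-ca+ba≡b-ac+b-a] (suc k) distinct = begin
    (b-ca k + X) + (ba k + d)   ≡⟨ interchange (b-ca k) X (ba k) d ⟩
    (b-ca k + ba k) + (X + d)   ≡⟨ cong (_+ (X + d)) (b-ca+ba≡b-ac+b-a] k (λ i<j j≤k → distinct i<j (m≤n⇒m≤1+n j≤k))) ⟩
    (b-ac k + b-a] k) + (X + d) ≡⟨ +-assoc (b-ac k) (b-a] k) (X + d) ⟩
    b-ac k + (b-a] k + (X + d)) ≡⟨ cong (b-ac k +_) (sym (+-assoc (b-a] k) X d)) ⟩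
    b-ac k + ((b-a] k + X) + d) ≡⟨ cong (λ z → b-ac k + (z + d)) exchange ⟩
    b-ac k + ((Y + T) + d)      ≡⟨ cong (b-ac k +_) (+-assoc Y T d) ⟩
    b-ac k + (Y + (T + d))      ≡⟨ sym (+-assoc (b-ac k) Y (T + d)) ⟩
    (b-ac k + Y) + (T + d)      ∎
    where
    open ≡-Reasoning
    X = between (a (suc k)) (a k) k
    Y = between (a k) (a (suc k)) k
    T = above (a (suc k)) k
    d = iverson (a (suc k) <? a k)
    exchange : b-a] k + X ≡ Y + T
    exchange = above-between-exchange k (λ i i<k → distinct i<k (m≤n⇒m≤1+n ≤-refl))
                                        (λ i i<k → distinct (m<n⇒m<1+n i<k) ≤-refl)

val-fromℕ< : ∀ {n} (π : Permutation′ n) {i} (i<n : i < n) → val π i ≡ toℕ (π ⟨$⟩ʳ fromℕ< i<n)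
val-fromℕ< {n} π {i} i<n with i <? n
... | yes _   = refl
... | no  i≮n = ⊥-elim (i≮n i<n)

val-injective : ∀ {n} (π : Permutation′ n) {i j} (i<n : i < n) (j<n : j < n) →
  val π i ≡ val π j → i ≡ j
val-injective π {i} {j} i<n j<n πi≡πj =
  fromℕ<-injective i j i<n j<n (Injection.injective (↔⇒↣ π)
    (toℕ-injective (trans (sym (val-fromℕ< π i<n)) (trans πi≡πj (val-fromℕ< π j<n)))))

lemma1 : (n : ℕ) → n ≥ 1 → (π : Permutation′ n) →
    pat-b-ca π + pat-ba π ≡ pat-b-ac π + pat-b-a] π
lemma1 (suc m) _ π = begin
  pat-b-ca π + pat-ba π ≡⟨ cong₂ _+_ (length-filter-pairs _ m) (length-filter-positions _ m) ⟩
  b-ca m + ba m         ≡⟨ b-ca+ba≡b-ac+b-a] m distinct ⟩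
  b-ac m + b-a] m       ≡⟨ sym (cong₂ _+_ (length-filter-pairs _ m) (length-filter-positions _ m)) ⟩
  pat-b-ac π + pat-b-a] π ∎
  where
  open ≡-Reasoning
  open PrefixCounts (val π)
  distinct : DistinctUpTo m
  distinct {i} {j} i<j j≤m πi≡πj =
    <-irrefl (val-injective π (<-≤-trans i<j (m≤n⇒m≤1+n j≤m)) (s≤s j≤m) πi≡πj) i<j
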